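{- Let $(M,\mathrm{acc},\mathrm{rej})$ be a monitoring system that is maximal for the collection $2^{\mathrm{Act}^\infty}$ of all properties, and let the classes $\mathcal{S},\mathcal{U},\mathcal{PU},\mathcal{P},\mathcal{SC},\mathcal{VC},\mathcal{C}$ be defined with respect to this system as in the context. Then $$\mathcal{C}\subseteq \mathcal{SC}\subseteq \mathcal{P},\qquad \mathcal{C}\subseteq \mathcal{VC}\subseteq \mathcal{P},\qquad \mathcal{P}=\mathcal{SC}\cup\mathcal{VC}\subseteq \mathcal{PU}\subseteq \mathcal{U}\subseteq \mathcal{S}.$$
   Context: Fix a finite set $\mathrm{Act}$ of actions. Finite traces are elements of $\mathrm{Act}^*$, infinite traces elements of $\mathrm{Act}^\omega$, and finfinite traces elements of $\mathrm{Act}^\infty=\mathrm{Act}^*\cup\mathrm{Act}^\omega$. Write $s\preceq f$ when the finite trace $s$ is a prefix of $f$. A property is a subset $P\subseteq\mathrm{Act}^\infty$. A finite trace $s$ positively (resp. negatively) determines $P$ if $sf\in P$ (resp. $sf\notin P$) for every $f\in\mathrm{Act}^\infty$. A monitoring system is a triple $(M,\mathrm{acc},\mathrm{rej})$ where $M$ is a nonempty set of monitors and $\mathrm{acc},\mathrm{rej}\subseteq M\times\mathrm{Act}^\infty$, such that for every $m\in M$: (1) if $\mathrm{acc}(m,f)$ then $\mathrm{acc}(m,s)$ for some finite $s\preceq f$, and likewise for $\mathrm{rej}$; (2) if $\mathrm{acc}(m,s)$ for finite $s$ then $\mathrm{acc}(m,sf)$ for all $f\in\mathrm{Act}^\infty$,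 and likewise for $\mathrm{rej}$. It is maximal for a collection $C$ of properties if for every $P\in C$ there is $m_P\in M$ such that $\mathrm{acc}(m_P,f)$ iff $f$ has a finite prefix that positively determines $P$, and $\mathrm{rej}(m_P,f)$ iff $f$ has a finite prefix that negatively determines $P$. A monitor $m$ is sound for $P$ if $\mathrm{acc}(m,f)$ implies $f\in P$ and $\mathrm{rej}(m,f)$ implies $f\notin P$; satisfaction-complete for $P$ if $f\in P$ implies $\mathrm{acc}(m,f)$; violation-complete for $P$ if $f\notin P$ implies $\mathrm{rej}(m,f)$; complete if both. $m$ is informative if $\exists f.\,(\mathrm{acc}(m,f)$ or $\mathrm{rej}(m,f))$, and persistently informative if for every $s\in\mathrm{Act}^*$ there is $f\in\mathrm{Act}^\infty$ with $\mathrm{acc}(m,sf)$ or $\mathrm{rej}(m,sf)$. Classes (all with monitors from $M$): $\mathcal{S}$ = properties having a sound monitor; $\mathcal{U}$ = properties having a sound informative monitor; $\mathcal{PU}$ = properties having a sound persistently informative monitor; $\mathcal{SC}$ (resp. $\mathcal{VC}$) = properties having a monitor that is sound and satisfaction-complete (resp. violation-complete); $\mathcal{P}$ = properties in $\mathcal{SC}$ or in $\mathcal{VC}$; $\mathcal{C}$ = properties having a sound and complete monitor. -}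

module Defs where

open import Level using (0ℓ)
open import Data.Nat using (ℕ; zero; suc)
open import Data.List using (List; []; _∷_; _++_)
open import Data.Product using (Σ; ∃; _×_; _,_)
open import Data.Sum using (_⊎_)
open import Data.Empty using (⊥)
open import Relation.Nullary using (¬_)
open import Relation.Binary.PropositionalEquality using (_≡_)

data Trace (Act : Set) : Set where
  fin : List Act → Trace Act
  inf : (ℕ → Act) → Trace Act

module _ {Act : Set} where

  prepend : List Act → (ℕ → Act) → ℕ → Act
  prepend []      g i       = g i
  prepend (a ∷ s) g zero    = a
  prepend (a ∷ s) g (suc i) = prepend s g i

  _·_ : List Act → Trace Act → Trace Act
  s · fin t = fin (s ++ t)
  s · inf g = inf (prepend s g)

  _≈_ : Trace Act → Trace Act → Set
  fin s ≈ fin t = s ≡ t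
  fin s ≈ inf h = ⊥
  inf g ≈ fin t = ⊥
  inf g ≈ inf h = ∀ i → g i ≡ h i

  data _≼_ : List Act → Trace Act → Set where
    []≼    : ∀ {f} → [] ≼ f
    ∷≼fin  : ∀ {a s t} → s ≼ fin t → (a ∷ s) ≼ fin (a ∷ t)
    ∷≼inf  : ∀ {a s g} → g zero ≡ a → s ≼ inf (λ i → g (suc i)) → (a ∷ s) ≼ inf g

  Respects≈ : (Trace Act → Set) → Set
  Respects≈ R = ∀ {f g} → f ≈ g → R f → R g

record Property (Act : Set) : Set₁ where
  field
    holds  : Trace Act → Set
    respP  : Respects≈ holds
open Property public

_∈_ : {Act : Set} → Trace Act → Property Act → Set
f ∈ P = holds P f

module _ {Act : Set} where

  PosDet : Property Act → List Act → Set
  PosDet P s = ∀ f → (s · f) ∈ P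

  NegDet : Property Act → List Act → Set
  NegDet P s = ∀ f → ¬ ((s · f) ∈ P)

record MonitoringSystem (Act : Set) : Set₁ where
  field
    M    : Set
    inhabited : M
    acc  : M → Trace Act → Set
    rej  : M → Trace Act → Set
    acc-resp : ∀ m → Respects≈ (acc m)
    rej-resp : ∀ m → Respects≈ (rej m)
    acc-fin : ∀ m f → acc m f → ∃ λ s → s ≼ f × acc m (fin s)
    rej-fin : ∀ m f → rej m f → ∃ λ s → s ≼ f × rej m (fin s)
    acc-ext : ∀ m s f → acc m (fin s) → acc m (s · f)
    rej-ext : ∀ m s f → rej m (fin s) → rej m (s · f)

module _ {Act : Set} (MS : MonitoringSystem Act) where
  open MonitoringSystem MS

  MaximalForAll : Set₁
  MaximalForAll = ∀ (P : Property Act) → Σ M λ mP →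
      (∀ f → (acc mP f → ∃ λ s → s ≼ f × PosDet P s)
           × ((∃ λ s → s ≼ f × PosDet P s) → acc mP f))
    × (∀ f → (rej mP f → ∃ λ s → s ≼ f × NegDet P s)
           × ((∃ λ s → s ≼ f × NegDet P s) → rej mP f))

  Sound : M → Property Act → Set
  Sound m P = (∀ f → acc m f → f ∈ P) × (∀ f → rej m f → ¬ (f ∈ P))
   

  SatComplete : M → Property Act → Set
  SatComplete m P = ∀ f → f ∈ P → acc m f
   

  VioComplete : M → Property Act → Set
  VioComplete m P = ∀ f → ¬ (f ∈ P) → rej m f
   

  Complete : M → Property Act → Set
  Complete m P = SatComplete m P × VioComplete m P

  Informative : M → Set
  Informative m = ∃ λ f → acc m f ⊎ rej m f

  PersistentlyInformative : M → Set
  PersistentlyInformative m = ∀ (s : List Act) → ∃ λ f → acc m (s · f) ⊎ rej m (s · f)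

  Class : Set₁
  Class = Property Act → Set

  𝒮 𝒰 𝒫𝒰 𝒮𝒞 𝒱𝒞 𝒫 𝒞 : Class
  𝒮  P = Σ M λ m → Sound m P
  𝒰  P = Σ M λ m → Sound m P × Informative m
  𝒫𝒰 P = Σ M λ m → Sound m P × PersistentlyInformative m
  𝒮𝒞 P = Σ M λ m → Sound m P × SatComplete m P
  𝒱𝒞 P = Σ M λ m → Sound m P × VioComplete m P
  𝒫  P = 𝒮𝒞 P ⊎ 𝒱𝒞 P
  𝒞  P = Σ M λ m → Sound m P × Complete m P

module _ {Act : Set} where
  _⊆ᶜ_ : (Property Act → Set) → (Property Act → Set) → Set₁
  C ⊆ᶜ D = ∀ P → C P → D P

  _∪ᶜ_ : (Property Act → Set) → (Property Act → Set) → Property Act → Set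
  (C ∪ᶜ D) P = C P ⊎ D P

  _≡ᶜ_ : (Property Act → Set) → (Property Act → Set) → Set₁
  C ≡ᶜ D = (C ⊆ᶜ D) × (D ⊆ᶜ C)

module Submission where

-- A sound monitor accepts only after a finite prefix whose every extension it also accepts, so that
-- prefix positively determines P; hence the monitor of a maximal system accepts whenever any sound
-- monitor does, and dually for rejection. Now let P have a sound satisfaction-complete monitor and let
-- s be finite. Either some extension s f lies in P, which that monitor and therefore the maximal one
-- accepts, or none does, so s negatively determines P and the maximal monitor rejects s. Dually for
-- violation-complete monitors (using excluded middle to see that s positively determines P when no
-- extension violates it). So every property of 𝒫 has a sound persistently informative monitor; the
-- remaining inclusions merely forget or regroup components.

open import Defs
open import Level using (0ℓ)
open import Data.Nat using (ℕ; zero; suc)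
open import Data.Fin using (Fin)
open import Data.List using (List; []; _∷_)
open import Data.Product using (_×_; _,_; ∃; proj₁; proj₂; curry)
open import Data.Sum using (inj₁; inj₂)
open import Function using (id)
open import Relation.Nullary using (¬_; yes; no)
open import Relation.Binary.PropositionalEquality using (refl; sym; cong)
open import Axiom.ExcludedMiddle using (ExcludedMiddle)
open import Axiom.DoubleNegationElimination using (em⇒dne)

module _ {Act : Set} where

  ≈-sym : {f g : Trace Act} → f ≈ g → g ≈ f
  ≈-sym {fin _} {fin _} e   = sym e
  ≈-sym {inf _} {inf _} e i = sym (e i)

  ≼-· : (s : List Act) (f : Trace Act) → s ≼ (s · f)
  ≼-· []      f       = []≼
  ≼-· (a ∷ s) (fin t) = ∷≼fin (≼-· s (fin t))
  ≼-· (a ∷ s) (inf g) = ∷≼inf refl (≼-· s (inf g))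

  ≼⇒· : {s : List Act} {f : Trace Act} → s ≼ f → ∃ λ g → (s · g) ≈ f
  ≼⇒· {f = fin t} []≼ = fin t , refl
  ≼⇒· {f = inf h} []≼ = inf h , λ _ → refl
  ≼⇒· (∷≼fin p) with ≼⇒· p
  ... | fin u , e = fin u , cong (_ ∷_) e
  ≼⇒· (∷≼inf e₀ p) with ≼⇒· p
  ... | inf u , e = inf u , λ { zero → sym e₀ ; (suc i) → e i }

  PosDet-≼ : (P : Property Act) {s : List Act} {f : Trace Act} →
             s ≼ f → PosDet P s → f ∈ P
  PosDet-≼ P s≼f d with ≼⇒· s≼f
  ... | g , e = respP P e (d g)

  NegDet-≼ : (P : Property Act) {s : List Act} {f : Trace Act} →
             s ≼ f → NegDet P s → ¬ (f ∈ P)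
  NegDet-≼ P s≼f d f∈P with ≼⇒· s≼f
  ... | g , e = d g (respP P (≈-sym e) f∈P)

module _ {Act : Set} (MS : MonitoringSystem Act) where
  open MonitoringSystem MS

  sound-acc⇒PosDet : ∀ {m} (P : Property Act) → Sound MS m P →
                     ∀ f → acc m f → ∃ λ s → s ≼ f × PosDet P s
  sound-acc⇒PosDet {m} P (acc⇒∈ , _) f a with acc-fin m f a
  ... | s , s≼f , as = s , s≼f , λ g → acc⇒∈ (s · g) (acc-ext m s g as)

  sound-rej⇒NegDet : ∀ {m} (P : Property Act) → Sound MS m P →
                     ∀ f → rej m f → ∃ λ s → s ≼ f × NegDet P s
  sound-rej⇒NegDet {m} P (_ , rej⇒∉) f r with rej-fin m f r
  ... | s , s≼f , rs = s , s≼f , λ g → rej⇒∉ (s · g) (rej-ext m s g rs)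

  module Maximal (max : MaximalForAll MS) (P : Property Act) where

    mP : M
    mP = proj₁ (max P)

    acc-mP⇔ : ∀ f → (acc mP f → ∃ λ s → s ≼ f × PosDet P s)
                  × ((∃ λ s → s ≼ f × PosDet P s) → acc mP f)
    acc-mP⇔ = proj₁ (proj₂ (max P))

    rej-mP⇔ : ∀ f → (rej mP f → ∃ λ s → s ≼ f × NegDet P s)
                  × ((∃ λ s → s ≼ f × NegDet P s) → rej mP f)
    rej-mP⇔ = proj₂ (proj₂ (max P))

    mP-sound : Sound MS mP P
    mP-sound = (λ f a → let s , s≼f , d = proj₁ (acc-mP⇔ f) a in PosDet-≼ P s≼f d)
             , (λ f r → let s , s≼f , d = proj₁ (rej-mP⇔ f) r in NegDet-≼ P s≼f d)

    sound-acc⇒acc-mP : ∀ {m} → Sound MS m P → ∀ f → acc m f → acc mP f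
    sound-acc⇒acc-mP snd f a = proj₂ (acc-mP⇔ f) (sound-acc⇒PosDet P snd f a)

    sound-rej⇒rej-mP : ∀ {m} → Sound MS m P → ∀ f → rej m f → rej mP f
    sound-rej⇒rej-mP snd f r = proj₂ (rej-mP⇔ f) (sound-rej⇒NegDet P snd f r)

    NegDet⇒rej-mP : ∀ {s} → NegDet P s → rej mP (s · fin [])
    NegDet⇒rej-mP {s} d = proj₂ (rej-mP⇔ (s · fin [])) (s , ≼-· s (fin []) , d)

    PosDet⇒acc-mP : ∀ {s} → PosDet P s → acc mP (s · fin [])
    PosDet⇒acc-mP {s} d = proj₂ (acc-mP⇔ (s · fin [])) (s , ≼-· s (fin []) , d)

  𝒫⊆𝒫𝒰 : ExcludedMiddle 0ℓ → MaximalForAll MS → 𝒫 MS ⊆ᶜ 𝒫𝒰 MS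
  𝒫⊆𝒫𝒰 em max P p = mP , mP-sound , informative p
    where
    open Maximal max P

    informative : 𝒫 MS P → PersistentlyInformative MS mP
    informative (inj₁ (m , snd , sc)) s with em {∃ λ f → (s · f) ∈ P}
    ... | yes (f , ∈P) = f , inj₁ (sound-acc⇒acc-mP snd (s · f) (sc (s · f) ∈P))
    ... | no ∄        = fin [] , inj₂ (NegDet⇒rej-mP (curry ∄))
    informative (inj₂ (m , snd , vc)) s with em {∃ λ f → ¬ ((s · f) ∈ P)}
    ... | yes (f , ∉P) = f , inj₂ (sound-rej⇒rej-mP snd (s · f) (vc (s · f) ∉P))
    ... | no ∄        = fin [] , inj₁ (PosDet⇒acc-mP (λ f → em⇒dne em (curry ∄ f)))

theorem1 : ExcludedMiddle 0ℓ → (n : ℕ) → (MS : MonitoringSystem (Fin n)) → MaximalForAll MS →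
    (𝒞 MS ⊆ᶜ 𝒮𝒞 MS) × (𝒮𝒞 MS ⊆ᶜ 𝒫 MS) × (𝒞 MS ⊆ᶜ 𝒱𝒞 MS) × (𝒱𝒞 MS ⊆ᶜ 𝒫 MS)
    × (𝒫 MS ≡ᶜ (𝒮𝒞 MS ∪ᶜ 𝒱𝒞 MS)) × (𝒫 MS ⊆ᶜ 𝒫𝒰 MS) × (𝒫𝒰 MS ⊆ᶜ 𝒰 MS) × (𝒰 MS ⊆ᶜ 𝒮 MS)
theorem1 em n MS max =
    (λ { P (m , snd , sc , _) → m , snd , sc })
  , (λ P → inj₁)
  , (λ { P (m , snd , _ , vc) → m , snd , vc })
  , (λ P → inj₂)
  , ((λ P → id) , (λ P → id))
  , 𝒫⊆𝒫𝒰 MS em max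
  , (λ { P (m , snd , pi) → m , snd , [] · proj₁ (pi []) , proj₂ (pi []) })
  , (λ { P (m , snd , _) → m , snd })
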